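{- Let $m\ge1$, identify $X=\{x_1,\dots,x_m\}$ with the coordinates of $\mathbb R^m$, and for nonempty $T\subseteq X$ let $Q_T=\operatorname{diag}(\mathbf 1_T)-\frac{1}{|T|}\mathbf 1_T\mathbf 1_T^\top+\frac1m J$, where $\mathbf 1_T$ is the indicator vector of $T$ and $J$ is the $m\times m$ all-ones matrix. Then for nonempty subsets $I,T\subseteq X$, \[ \operatorname{tr}(Q_IQ_T)=|I\cap T|+\frac{|I\setminus T|\,|T\setminus I|}{|I|\,|T|}\ge |I\cap T|, \] with equality if and only if $I\subseteq T$ or $T\subseteq I$. -}

module Defs where

open import Data.Nat using (ℕ; zero; suc; NonZero)
open import Data.Integer using (+_)
open import Data.Fin using (Fin; zero; suc; _≟_)
open import Data.Fin.Subset using (Subset; ∣_∣)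
open import Data.Vec using (lookup)
open import Data.Bool using (true; false)
open import Data.Rational using (ℚ; 0ℚ; 1ℚ; _+_; _-_; _*_; _/_)
open import Relation.Nullary using (yes; no)

Matrix : ℕ → Set
Matrix m = Fin m → Fin m → ℚ

Σ : ∀ {m} → (Fin m → ℚ) → ℚ
Σ {zero}  f = 0ℚ
Σ {suc m} f = f zero + Σ (λ i → f (suc i))

tr : ∀ {m} → Matrix m → ℚ
tr A = Σ (λ i → A i i)

_⊗_ : ∀ {m} → Matrix m → Matrix m → Matrix m
(A ⊗ B) i k = Σ (λ j → A i j * B j k)

𝟏 : ∀ {m} → Subset m → Fin m → ℚ
𝟏 T i with lookup T i
... | true  = 1ℚ
... | false = 0ℚ

diag𝟏 : ∀ {m} → Subset m → Matrix m
diag𝟏 T i j with i ≟ j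
... | yes _ = 𝟏 T i
... | no  _ = 0ℚ

Q : ∀ m .{{_ : NonZero m}} (T : Subset m) .{{_ : NonZero ∣ T ∣}} → Matrix m
Q m T i j = diag𝟏 T i j - (+ 1 / ∣ T ∣) * (𝟏 T i * 𝟏 T j) + (+ 1 / m)

ℕ→ℚ : ℕ → ℚ
ℕ→ℚ n = + n / 1

{-# OPTIONS --safe #-}
-- Split Q_T = P_T + J/m with P_T = diag(1_T) - 1_T 1_Tᵀ/|T|. Every row and column of P_T sums
-- to zero, so the cross terms with J drop out and tr(Q_I Q_T) = tr(P_I P_T) + 1. Since indicator
-- entries are idempotent, (P_I P_T)_ii = (1 - 1/|I| - 1/|T| + c/(|I||T|)) 1_{I∩T}(i) with
-- c = |I ∩ T|, hence tr(Q_I Q_T) = c + (1 - c/|I|)(1 - c/|T|) = c + |I∖T||T∖I|/(|I||T|).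
-- The excess is nonnegative and vanishes exactly when I∖T or T∖I is empty.

module Submission where

open import Defs
open import Data.Nat using (ℕ; NonZero) renaming (_*_ to _*ℕ_)
open import Data.Fin.Subset using (Subset; ∣_∣; _∩_; _─_; _⊆_)
open import Data.Integer using (+_)
open import Data.Rational using (ℚ; _+_; _*_; _/_; _≤_)
open import Data.Product using (_×_)
open import Data.Sum using (_⊎_)
open import Function.Bundles using (_⇔_)
open import Relation.Binary.PropositionalEquality using (_≡_)

open import Algebra.Bundles using (CommutativeRing)
open import Data.Bool using (true; false; _∧_)
open import Data.Fin using (Fin; zero; suc; _≟_; punchIn)
open import Data.Fin.Properties using (punchInᵢ≢i)
open import Data.Fin.Subset.Properties using (∩-comm; s⊆s; out⊆; drop-∷-⊆)
import Data.Integer as ℤ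
import Data.Integer.Properties as ℤ
open import Data.Nat as ℕ using (zero; suc)
import Data.Nat.Properties as ℕ
open import Data.Nat.Coprimality using (1-coprimeTo) renaming (sym to coprime-sym)
open import Data.Product using (_,_)
open import Data.Rational using (mkℚ; 0ℚ; 1ℚ; -_; _-_; NonNegative; Positive)
open import Data.Rational.Properties
  using ( +-*-commutativeRing; +-0-group; normalize-coprime; normalize-pos; normalize-nonNeg
        ; +-identityˡ; +-identityʳ; +-assoc; *-identityˡ; *-identityʳ; *-zeroˡ; *-comm; *-distribʳ-+
        ; *-inverseʳ; *-zeroʳ; nonNeg*nonNeg⇒nonNeg; pos*pos⇒pos; nonNegative⁻¹; positive⁻¹; +-monoʳ-≤; <⇒≢; pos⇒nonNeg )
  renaming (_≟_ to _≟ℚ_)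
open import Algebra.Properties.Semiring.Sum (CommutativeRing.semiring +-*-commutativeRing)
  using (sum; ∑-distrib-+; *-distribˡ-sum; sum-remove; sum-cong-≗; sum-replicate-zero)
open import Algebra.Properties.Group +-0-group using (identityʳ-unique)
open import Data.Vec using ([]; _∷_; lookup; here)
open import Data.Vec.Properties using (lookup-zipWith)
open import Function using (_∘_)
open import Function.Bundles using (mk⇔)
open import Function.Properties.Equivalence using () renaming (trans to ⇔-trans)
import Data.Sum as Sum
open import Level using (0ℓ)
open import Relation.Binary.PropositionalEquality using (refl; sym; trans; cong; cong₂; subst; _≢_; module ≡-Reasoning)
open import Relation.Nullary using (yes; no; contradiction)
open import Relation.Nullary.Decidable using (dec⇒maybe)
open import Tactic.RingSolver using (solve-∀)
open import Tactic.RingSolver.Core.AlmostCommutativeRing using (AlmostCommutativeRing; fromCommutativeRing)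

ℚ-ring : AlmostCommutativeRing 0ℓ 0ℓ
ℚ-ring = fromCommutativeRing +-*-commutativeRing (λ x → dec⇒maybe (0ℚ ≟ℚ x))

open ≡-Reasoning

ℕ→ℚ≡mkℚ : ∀ n → ℕ→ℚ n ≡ mkℚ (+ n) 0 (coprime-sym (1-coprimeTo n))
ℕ→ℚ≡mkℚ n = normalize-coprime (coprime-sym (1-coprimeTo n))

ℕ→ℚ-suc : ∀ n → ℕ→ℚ (suc n) ≡ 1ℚ + ℕ→ℚ n
ℕ→ℚ-suc n rewrite ℕ→ℚ≡mkℚ n = cong (λ k → (+ 1 ℤ.+ k) / 1) (sym (ℤ.*-identityʳ (+ n)))

ℕ→ℚ-+ : ∀ a b → ℕ→ℚ (a ℕ.+ b) ≡ ℕ→ℚ a + ℕ→ℚ b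
ℕ→ℚ-+ zero    b = sym (+-identityˡ (ℕ→ℚ b))
ℕ→ℚ-+ (suc a) b = begin
  ℕ→ℚ (suc (a ℕ.+ b))   ≡⟨ ℕ→ℚ-suc (a ℕ.+ b) ⟩
  1ℚ + ℕ→ℚ (a ℕ.+ b)    ≡⟨ cong (λ x → 1ℚ + x) (ℕ→ℚ-+ a b) ⟩
  1ℚ + (ℕ→ℚ a + ℕ→ℚ b)  ≡⟨ +-assoc 1ℚ (ℕ→ℚ a) (ℕ→ℚ b) ⟨
  1ℚ + ℕ→ℚ a + ℕ→ℚ b    ≡⟨ cong (_+ ℕ→ℚ b) (ℕ→ℚ-suc a) ⟨
  ℕ→ℚ (suc a) + ℕ→ℚ b   ∎

ℕ→ℚ-* : ∀ a b → ℕ→ℚ (a ℕ.* b) ≡ ℕ→ℚ a * ℕ→ℚ b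
ℕ→ℚ-* zero    b = sym (*-zeroˡ (ℕ→ℚ b))
ℕ→ℚ-* (suc a) b = begin
  ℕ→ℚ (b ℕ.+ a ℕ.* b)          ≡⟨ ℕ→ℚ-+ b (a ℕ.* b) ⟩
  ℕ→ℚ b + ℕ→ℚ (a ℕ.* b)        ≡⟨ cong₂ _+_ (*-identityˡ (ℕ→ℚ b)) (sym (ℕ→ℚ-* a b)) ⟨
  1ℚ * ℕ→ℚ b + ℕ→ℚ a * ℕ→ℚ b   ≡⟨ *-distribʳ-+ (ℕ→ℚ b) 1ℚ (ℕ→ℚ a) ⟨
  (1ℚ + ℕ→ℚ a) * ℕ→ℚ b         ≡⟨ cong (_* ℕ→ℚ b) (ℕ→ℚ-suc a) ⟨
  ℕ→ℚ (suc a) * ℕ→ℚ b          ∎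

ℕ→ℚ-*-inverse : ∀ n .{{_ : NonZero n}} → ℕ→ℚ n * (+ 1 / n) ≡ 1ℚ
ℕ→ℚ-*-inverse (suc k) rewrite ℕ→ℚ≡mkℚ (suc k) | normalize-coprime (1-coprimeTo (suc k)) =
  *-inverseʳ (mkℚ (+ suc k) 0 (coprime-sym (1-coprimeTo (suc k))))

Σ≡sum : ∀ {m} (f : Fin m → ℚ) → Σ f ≡ sum f
Σ≡sum {zero}  f = refl
Σ≡sum {suc m} f = cong (λ x → f zero + x) (Σ≡sum (f ∘ suc))

Σ-cong : ∀ {m} {f g : Fin m → ℚ} → (∀ i → f i ≡ g i) → Σ f ≡ Σ g
Σ-cong {f = f} {g} f≗g = begin
  Σ f    ≡⟨ Σ≡sum f ⟩
  sum f  ≡⟨ sum-cong-≗ f≗g ⟩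
  sum g  ≡⟨ Σ≡sum g ⟨
  Σ g    ∎

Σ-+ : ∀ {m} (f g : Fin m → ℚ) → Σ (λ i → f i + g i) ≡ Σ f + Σ g
Σ-+ f g rewrite Σ≡sum (λ i → f i + g i) | Σ≡sum f | Σ≡sum g = ∑-distrib-+ f g

Σ-*ˡ : ∀ {m} k (f : Fin m → ℚ) → Σ (λ i → k * f i) ≡ k * Σ f
Σ-*ˡ k f rewrite Σ≡sum (λ i → k * f i) | Σ≡sum f = sym (*-distribˡ-sum k f)

Σ-const : ∀ {m} k → Σ {m} (λ _ → k) ≡ ℕ→ℚ m * k
Σ-const {zero}  k = sym (*-zeroˡ k)
Σ-const {suc m} k = begin
  k + Σ {m} (λ _ → k)      ≡⟨ cong₂ _+_ (*-identityˡ k) (sym (Σ-const {m} k)) ⟨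
  1ℚ * k + ℕ→ℚ m * k       ≡⟨ *-distribʳ-+ k 1ℚ (ℕ→ℚ m) ⟨
  (1ℚ + ℕ→ℚ m) * k         ≡⟨ cong (_* k) (ℕ→ℚ-suc m) ⟨
  ℕ→ℚ (suc m) * k          ∎

Σ-pick : ∀ {m} (f : Fin m → ℚ) i → (∀ j → j ≢ i → f j ≡ 0ℚ) → Σ f ≡ f i
Σ-pick {suc m} f i f-vanishes = begin
  Σ f                               ≡⟨ Σ≡sum f ⟩
  sum f                             ≡⟨ sum-remove f ⟩
  f i + sum (f ∘ punchIn i)         ≡⟨ cong (λ x → f i + x) (sum-cong-≗ λ j → f-vanishes _ (punchInᵢ≢i i j)) ⟩
  f i + sum {m} (λ _ → 0ℚ)          ≡⟨ cong (λ x → f i + x) (sum-replicate-zero m) ⟩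
  f i + 0ℚ                          ≡⟨ +-identityʳ (f i) ⟩
  f i                               ∎

𝟏-idem : ∀ {m} (T : Subset m) i → 𝟏 T i * 𝟏 T i ≡ 𝟏 T i
𝟏-idem T i with lookup T i
... | true  = refl
... | false = refl

𝟏-∩ : ∀ {m} (I T : Subset m) i → 𝟏 I i * 𝟏 T i ≡ 𝟏 (I ∩ T) i
𝟏-∩ I T i rewrite lookup-zipWith _∧_ i I T with lookup I i | lookup T i
... | true  | true  = refl
... | true  | false = refl
... | false | true  = refl
... | false | false = refl

𝟏-∷ : ∀ {m} x (T : Subset m) i → 𝟏 (x ∷ T) (suc i) ≡ 𝟏 T i
𝟏-∷ x T i with lookup T i
... | true  = refl
... | false = refl

Σ-𝟏 : ∀ {m} (T : Subset m) → Σ (𝟏 T) ≡ ℕ→ℚ ∣ T ∣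
Σ-𝟏 {zero}  []          = refl
Σ-𝟏 {suc m} (true ∷ T)  = begin
  1ℚ + Σ (𝟏 (true ∷ T) ∘ suc)  ≡⟨ cong (λ x → 1ℚ + x) (trans (Σ-cong (𝟏-∷ true T)) (Σ-𝟏 T)) ⟩
  1ℚ + ℕ→ℚ ∣ T ∣               ≡⟨ ℕ→ℚ-suc ∣ T ∣ ⟨
  ℕ→ℚ (suc ∣ T ∣)              ∎
Σ-𝟏 {suc m} (false ∷ T) = begin
  0ℚ + Σ (𝟏 (false ∷ T) ∘ suc) ≡⟨ +-identityˡ _ ⟩
  Σ (𝟏 (false ∷ T) ∘ suc)      ≡⟨ Σ-cong (𝟏-∷ false T) ⟩
  Σ (𝟏 T)                      ≡⟨ Σ-𝟏 T ⟩
  ℕ→ℚ ∣ T ∣                    ∎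

diag𝟏-on : ∀ {m} (T : Subset m) i → diag𝟏 T i i ≡ 𝟏 T i
diag𝟏-on T i with i ≟ i
... | yes _   = refl
... | no i≢i  = contradiction refl i≢i

diag𝟏-off : ∀ {m} (T : Subset m) {i j} → i ≢ j → diag𝟏 T i j ≡ 0ℚ
diag𝟏-off T {i} {j} i≢j with i ≟ j
... | yes i≡j = contradiction i≡j i≢j
... | no _    = refl

diag𝟏-sym : ∀ {m} (T : Subset m) i j → diag𝟏 T i j ≡ diag𝟏 T j i
diag𝟏-sym T i j with i ≟ j
... | yes refl = sym (diag𝟏-on T i)
... | no i≢j   = sym (diag𝟏-off T (i≢j ∘ sym))

Σ-diag𝟏 : ∀ {m} (T : Subset m) i (f : Fin m → ℚ) → Σ (λ j → diag𝟏 T i j * f j) ≡ 𝟏 T i * f i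
Σ-diag𝟏 T i f = trans (Σ-pick _ i vanishes) (cong (_* f i) (diag𝟏-on T i))
  where
  vanishes : ∀ j → j ≢ i → diag𝟏 T i j * f j ≡ 0ℚ
  vanishes j j≢i = trans (cong (_* f j) (diag𝟏-off T (j≢i ∘ sym))) (*-zeroˡ (f j))

∣p─q∣+∣p∩q∣≡∣p∣ : ∀ {n} (p q : Subset n) → ∣ p ─ q ∣ ℕ.+ ∣ p ∩ q ∣ ≡ ∣ p ∣
∣p─q∣+∣p∩q∣≡∣p∣ []           []           = refl
∣p─q∣+∣p∩q∣≡∣p∣ (true  ∷ p)  (true  ∷ q)  = trans (ℕ.+-suc ∣ p ─ q ∣ ∣ p ∩ q ∣) (cong suc (∣p─q∣+∣p∩q∣≡∣p∣ p q))
∣p─q∣+∣p∩q∣≡∣p∣ (true  ∷ p)  (false ∷ q)  = cong suc (∣p─q∣+∣p∩q∣≡∣p∣ p q)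
∣p─q∣+∣p∩q∣≡∣p∣ (false ∷ p)  (true  ∷ q)  = ∣p─q∣+∣p∩q∣≡∣p∣ p q
∣p─q∣+∣p∩q∣≡∣p∣ (false ∷ p)  (false ∷ q)  = ∣p─q∣+∣p∩q∣≡∣p∣ p q

∣p─q∣≡0⇒p⊆q : ∀ {n} (p q : Subset n) → ∣ p ─ q ∣ ≡ 0 → p ⊆ q
∣p─q∣≡0⇒p⊆q []          []           _ = λ ()
∣p─q∣≡0⇒p⊆q (true  ∷ p) (true  ∷ q)  e = s⊆s (∣p─q∣≡0⇒p⊆q p q e)
∣p─q∣≡0⇒p⊆q (false ∷ p) (true  ∷ q)  e = out⊆ (∣p─q∣≡0⇒p⊆q p q e)
∣p─q∣≡0⇒p⊆q (false ∷ p) (false ∷ q)  e = out⊆ (∣p─q∣≡0⇒p⊆q p q e)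

p⊆q⇒∣p─q∣≡0 : ∀ {n} (p q : Subset n) → p ⊆ q → ∣ p ─ q ∣ ≡ 0
p⊆q⇒∣p─q∣≡0 []          []          _   = refl
p⊆q⇒∣p─q∣≡0 (true  ∷ p) (true  ∷ q) p⊆q = p⊆q⇒∣p─q∣≡0 p q (drop-∷-⊆ p⊆q)
p⊆q⇒∣p─q∣≡0 (true  ∷ p) (false ∷ q) p⊆q with () ← p⊆q here
p⊆q⇒∣p─q∣≡0 (false ∷ p) (true  ∷ q) p⊆q = p⊆q⇒∣p─q∣≡0 p q (drop-∷-⊆ p⊆q)
p⊆q⇒∣p─q∣≡0 (false ∷ p) (false ∷ q) p⊆q = p⊆q⇒∣p─q∣≡0 p q (drop-∷-⊆ p⊆q)

Σ-+const-* : ∀ {m} (f g : Fin m → ℚ) s → Σ f ≡ 0ℚ → Σ g ≡ 0ℚ →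
             Σ (λ j → (f j + s) * (g j + s)) ≡ Σ (λ j → f j * g j) + ℕ→ℚ m * (s * s)
Σ-+const-* {m} f g s Σf≡0 Σg≡0 = begin
  Σ (λ j → (f j + s) * (g j + s))                               ≡⟨ Σ-cong (λ j → expand (f j) (g j) s) ⟩
  Σ (λ j → f j * g j + s * (f j + g j) + s * s)                 ≡⟨ Σ-+ {m} _ _ ⟩
  Σ (λ j → f j * g j + s * (f j + g j)) + Σ {m} (λ _ → s * s)   ≡⟨ cong₂ _+_ (Σ-+ {m} _ _) (Σ-const {m} (s * s)) ⟩
  Σ fg + Σ (λ j → s * (f j + g j)) + ℕ→ℚ m * (s * s)            ≡⟨ cong (λ x → Σ fg + x + ℕ→ℚ m * (s * s)) (Σ-*ˡ {m} s _) ⟩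
  Σ fg + s * Σ (λ j → f j + g j) + ℕ→ℚ m * (s * s)              ≡⟨ cong (λ x → Σ fg + s * x + ℕ→ℚ m * (s * s)) (Σ-+ f g) ⟩
  Σ fg + s * (Σ f + Σ g) + ℕ→ℚ m * (s * s)                      ≡⟨ cong₂ (λ x y → Σ fg + s * (x + y) + ℕ→ℚ m * (s * s)) Σf≡0 Σg≡0 ⟩
  Σ fg + s * (0ℚ + 0ℚ) + ℕ→ℚ m * (s * s)                        ≡⟨ drop (Σ fg) s (ℕ→ℚ m * (s * s)) ⟩
  Σ fg + ℕ→ℚ m * (s * s)                                        ∎
  where
  fg = λ j → f j * g j
  expand : ∀ a b s → (a + s) * (b + s) ≡ a * b + s * (a + b) + s * s
  expand = solve-∀ ℚ-ring
  drop : ∀ x s y → x + s * (0ℚ + 0ℚ) + y ≡ x + y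
  drop = solve-∀ ℚ-ring

tr-⊗-+const : ∀ {m} (A B : Matrix m) s → (∀ i → Σ (A i) ≡ 0ℚ) → (∀ i → Σ (λ j → B j i) ≡ 0ℚ) →
              tr ((λ i j → A i j + s) ⊗ (λ i j → B i j + s)) ≡ tr (A ⊗ B) + (ℕ→ℚ m * s) * (ℕ→ℚ m * s)
tr-⊗-+const {m} A B s rows cols = begin
  Σ (λ i → Σ (λ j → (A i j + s) * (B j i + s)))                ≡⟨ Σ-cong (λ i → Σ-+const-* (A i) (λ j → B j i) s (rows i) (cols i)) ⟩
  Σ (λ i → (A ⊗ B) i i + ℕ→ℚ m * (s * s))                      ≡⟨ Σ-+ {m} _ _ ⟩
  tr (A ⊗ B) + Σ {m} (λ _ → ℕ→ℚ m * (s * s))                   ≡⟨ cong (λ x → tr (A ⊗ B) + x) (Σ-const {m} _) ⟩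
  tr (A ⊗ B) + ℕ→ℚ m * (ℕ→ℚ m * (s * s))                       ≡⟨ cong (λ x → tr (A ⊗ B) + x) (square (ℕ→ℚ m) s) ⟩
  tr (A ⊗ B) + (ℕ→ℚ m * s) * (ℕ→ℚ m * s)                       ∎
  where
  square : ∀ n s → n * (n * (s * s)) ≡ (n * s) * (n * s)
  square = solve-∀ ℚ-ring

module _ {m} (T : Subset m) .{{_ : NonZero ∣ T ∣}} where

  private
    β = + 1 / ∣ T ∣

  P : Matrix m
  P i j = diag𝟏 T i j - β * (𝟏 T i * 𝟏 T j)

  P-sym : ∀ i j → P i j ≡ P j i
  P-sym i j = cong₂ (λ d x → d - β * x) (diag𝟏-sym T i j) (*-comm (𝟏 T i) (𝟏 T j))

  P-* : ∀ i (f : Fin m → ℚ) → Σ (λ j → P i j * f j) ≡ 𝟏 T i * (f i - β * Σ (λ j → f j * 𝟏 T j))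
  P-* i f = begin
    Σ (λ j → P i j * f j)                                                   ≡⟨ Σ-cong (λ j → expand (diag𝟏 T i j) (f j) β (𝟏 T i) (𝟏 T j)) ⟩
    Σ (λ j → diag𝟏 T i j * f j + - (β * 𝟏 T i) * (f j * 𝟏 T j))             ≡⟨ Σ-+ {m} _ _ ⟩
    Σ (λ j → diag𝟏 T i j * f j) + Σ (λ j → - (β * 𝟏 T i) * (f j * 𝟏 T j))   ≡⟨ cong₂ _+_ (Σ-diag𝟏 T i f) (Σ-*ˡ (- (β * 𝟏 T i)) (λ j → f j * 𝟏 T j)) ⟩
    𝟏 T i * f i + - (β * 𝟏 T i) * Σ (λ j → f j * 𝟏 T j)                     ≡⟨ factor (𝟏 T i) (f i) β _ ⟩
    𝟏 T i * (f i - β * Σ (λ j → f j * 𝟏 T j))                               ∎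
    where
    expand : ∀ d y b x z → (d - b * (x * z)) * y ≡ d * y + - (b * x) * (y * z)
    expand = solve-∀ ℚ-ring
    factor : ∀ x y b S → x * y + - (b * x) * S ≡ x * (y - b * S)
    factor = solve-∀ ℚ-ring

  P-row-sum : ∀ i → Σ (P i) ≡ 0ℚ
  P-row-sum i = begin
    Σ (P i)                                     ≡⟨ Σ-cong (λ j → *-identityʳ (P i j)) ⟨
    Σ (λ j → P i j * 1ℚ)                        ≡⟨ P-* i (λ _ → 1ℚ) ⟩
    𝟏 T i * (1ℚ - β * Σ (λ j → 1ℚ * 𝟏 T j))     ≡⟨ cong (λ x → 𝟏 T i * (1ℚ - β * x)) (trans (Σ-cong (*-identityˡ ∘ 𝟏 T)) (Σ-𝟏 T)) ⟩
    𝟏 T i * (1ℚ - β * ℕ→ℚ ∣ T ∣)                ≡⟨ cong (λ x → 𝟏 T i * (1ℚ - x)) (trans (*-comm β _) (ℕ→ℚ-*-inverse ∣ T ∣)) ⟩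
    𝟏 T i * 0ℚ                                  ≡⟨ *-zeroʳ (𝟏 T i) ⟩
    0ℚ                                          ∎

  P-col-sum : ∀ i → Σ (λ j → P j i) ≡ 0ℚ
  P-col-sum i = trans (Σ-cong (λ j → P-sym j i)) (P-row-sum i)

idempotent-identity : ∀ {x y} a b c → x * x ≡ x → y * y ≡ y →
                 x * ((y - b * (y * y)) - a * (y * (x - b * c))) ≡ (1ℚ - a - b + a * b * c) * (x * y)
idempotent-identity {x} {y} a b c xx≡x yy≡y = begin
  x * ((y - b * (y * y)) - a * (y * (x - b * c)))     ≡⟨ cong (λ z → x * ((y - b * z) - a * (y * (x - b * c)))) yy≡y ⟩
  x * ((y - b * y) - a * (y * (x - b * c)))           ≡⟨ expand x y a b c ⟩
  (1ℚ - b + a * b * c) * (x * y) - a * y * (x * x)    ≡⟨ cong (λ z → (1ℚ - b + a * b * c) * (x * y) - a * y * z) xx≡x ⟩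
  (1ℚ - b + a * b * c) * (x * y) - a * y * x          ≡⟨ collect x y a b c ⟩
  (1ℚ - a - b + a * b * c) * (x * y)                  ∎
  where
  expand : ∀ x y a b c → x * ((y - b * y) - a * (y * (x - b * c))) ≡ (1ℚ - b + a * b * c) * (x * y) - a * y * (x * x)
  expand = solve-∀ ℚ-ring
  collect : ∀ x y a b c → (1ℚ - b + a * b * c) * (x * y) - a * y * x ≡ (1ℚ - a - b + a * b * c) * (x * y)
  collect = solve-∀ ℚ-ring

1-∣p∩q∣/∣p∣≡∣p─q∣/∣p∣ : ∀ {m} (p q : Subset m) .{{_ : NonZero ∣ p ∣}} →
                        1ℚ - (+ 1 / ∣ p ∣) * ℕ→ℚ ∣ p ∩ q ∣ ≡ (+ 1 / ∣ p ∣) * ℕ→ℚ ∣ p ─ q ∣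
1-∣p∩q∣/∣p∣≡∣p─q∣/∣p∣ p q = begin
  1ℚ - α * c                                 ≡⟨ cong (λ x → x - α * c) α∣p∣≡1 ⟨
  α * ℕ→ℚ ∣ p ∣ - α * c                      ≡⟨ cong (λ n → α * ℕ→ℚ n - α * c) (∣p─q∣+∣p∩q∣≡∣p∣ p q) ⟨
  α * ℕ→ℚ (∣ p ─ q ∣ ℕ.+ ∣ p ∩ q ∣) - α * c  ≡⟨ cong (λ x → α * x - α * c) (ℕ→ℚ-+ ∣ p ─ q ∣ ∣ p ∩ q ∣) ⟩
  α * (d + c) - α * c                        ≡⟨ cancel α d c ⟩
  α * d                                      ∎
  where
  α = + 1 / ∣ p ∣
  c = ℕ→ℚ ∣ p ∩ q ∣
  d = ℕ→ℚ ∣ p ─ q ∣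
  α∣p∣≡1 : α * ℕ→ℚ ∣ p ∣ ≡ 1ℚ
  α∣p∣≡1 = trans (*-comm α _) (ℕ→ℚ-*-inverse ∣ p ∣)
  cancel : ∀ a d c → a * (d + c) - a * c ≡ a * d
  cancel = solve-∀ ℚ-ring

module _ {m} .{{_ : NonZero m}} (I T : Subset m) .{{_ : NonZero ∣ I ∣}} .{{_ : NonZero ∣ T ∣}} where

  private
    α = + 1 / ∣ I ∣
    β = + 1 / ∣ T ∣
    c = ℕ→ℚ ∣ I ∩ T ∣
    κ = 1ℚ - α - β + α * β * c

  P⊗P-diag : ∀ i → (P I ⊗ P T) i i ≡ κ * 𝟏 (I ∩ T) i
  P⊗P-diag i = begin
    Σ (λ j → P I i j * P T j i)                                 ≡⟨ P-* I i (λ j → P T j i) ⟩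
    𝟏 I i * (P T i i - α * Σ (λ j → P T j i * 𝟏 I j))
                                                                ≡⟨ cong₂ (λ d x → 𝟏 I i * ((d - β * (𝟏 T i * 𝟏 T i)) - α * x)) (diag𝟏-on T i) column ⟩
    𝟏 I i * ((𝟏 T i - β * (𝟏 T i * 𝟏 T i)) - α * (𝟏 T i * (𝟏 I i - β * c)))
                                                                ≡⟨ idempotent-identity α β c (𝟏-idem I i) (𝟏-idem T i) ⟩
    κ * (𝟏 I i * 𝟏 T i)                                         ≡⟨ cong (κ *_) (𝟏-∩ I T i) ⟩
    κ * 𝟏 (I ∩ T) i                                             ∎
    where
    column : Σ (λ j → P T j i * 𝟏 I j) ≡ 𝟏 T i * (𝟏 I i - β * c)
    column = begin
      Σ (λ j → P T j i * 𝟏 I j)                     ≡⟨ Σ-cong (λ j → cong (_* 𝟏 I j) (P-sym T j i)) ⟩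
      Σ (λ j → P T i j * 𝟏 I j)                     ≡⟨ P-* T i (𝟏 I) ⟩
      𝟏 T i * (𝟏 I i - β * Σ (λ j → 𝟏 I j * 𝟏 T j)) ≡⟨ cong (λ x → 𝟏 T i * (𝟏 I i - β * x)) (trans (Σ-cong (𝟏-∩ I T)) (Σ-𝟏 (I ∩ T))) ⟩
      𝟏 T i * (𝟏 I i - β * c)                       ∎

  tr-Q⊗Q : tr (Q m I ⊗ Q m T) ≡ c + (1ℚ - α * c) * (1ℚ - β * c)
  tr-Q⊗Q = begin
    tr (Q m I ⊗ Q m T)                        ≡⟨ tr-⊗-+const (P I) (P T) μ (P-row-sum I) (P-col-sum T) ⟩
    tr (P I ⊗ P T) + (ℕ→ℚ m * μ) * (ℕ→ℚ m * μ) ≡⟨ cong₂ (λ x y → x + y * y) tr-P⊗P (ℕ→ℚ-*-inverse m) ⟩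
    κ * c + 1ℚ * 1ℚ                           ≡⟨ rearrange α β c ⟩
    c + (1ℚ - α * c) * (1ℚ - β * c)           ∎
    where
    μ = + 1 / m
    tr-P⊗P : tr (P I ⊗ P T) ≡ κ * c
    tr-P⊗P = trans (Σ-cong P⊗P-diag) (trans (Σ-*ˡ κ (𝟏 (I ∩ T))) (cong (κ *_) (Σ-𝟏 (I ∩ T))))
    rearrange : ∀ a b c → (1ℚ - a - b + a * b * c) * c + 1ℚ * 1ℚ ≡ c + (1ℚ - a * c) * (1ℚ - b * c)
    rearrange = solve-∀ ℚ-ring

  tr-Q⊗Q-excess : tr (Q m I ⊗ Q m T) ≡ c + ℕ→ℚ (∣ I ─ T ∣ *ℕ ∣ T ─ I ∣) * α * β
  tr-Q⊗Q-excess = begin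
    tr (Q m I ⊗ Q m T)                               ≡⟨ tr-Q⊗Q ⟩
    c + (1ℚ - α * c) * (1ℚ - β * ℕ→ℚ ∣ I ∩ T ∣)       ≡⟨ cong (λ s → c + (1ℚ - α * c) * (1ℚ - β * ℕ→ℚ ∣ s ∣)) (∩-comm I T) ⟩
    c + (1ℚ - α * c) * (1ℚ - β * ℕ→ℚ ∣ T ∩ I ∣)       ≡⟨ cong₂ (λ x y → c + x * y) (1-∣p∩q∣/∣p∣≡∣p─q∣/∣p∣ I T) (1-∣p∩q∣/∣p∣≡∣p─q∣/∣p∣ T I) ⟩
    c + (α * p) * (β * q)                            ≡⟨ cong (λ x → c + x) (reorder α β p q) ⟩
    c + p * q * α * β                                ≡⟨ cong (λ x → c + x * α * β) (ℕ→ℚ-* ∣ I ─ T ∣ ∣ T ─ I ∣) ⟨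
    c + ℕ→ℚ (∣ I ─ T ∣ *ℕ ∣ T ─ I ∣) * α * β          ∎
    where
    p = ℕ→ℚ ∣ I ─ T ∣
    q = ℕ→ℚ ∣ T ─ I ∣
    reorder : ∀ a b x y → (a * x) * (b * y) ≡ x * y * a * b
    reorder = solve-∀ ℚ-ring

p≤p+q : ∀ p q .{{_ : NonNegative q}} → p ≤ p + q
p≤p+q p q = subst (_≤ p + q) (+-identityʳ p) (+-monoʳ-≤ p (nonNegative⁻¹ q))

p+q≡p⇔q≡0 : ∀ p q → p + q ≡ p ⇔ q ≡ 0ℚ
p+q≡p⇔q≡0 p q = mk⇔ (identityʳ-unique p q) (λ q≡0 → trans (cong (λ x → p + x) q≡0) (+-identityʳ p))

ℕ→ℚ*pos*pos-nonNeg : ∀ k a b .{{_ : Positive a}} .{{_ : Positive b}} → NonNegative (ℕ→ℚ k * a * b)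
ℕ→ℚ*pos*pos-nonNeg k a b = nonNeg*nonNeg⇒nonNeg (ℕ→ℚ k * a) {{ka-nonNeg}} b {{pos⇒nonNeg b}}
  where
  ka-nonNeg : NonNegative (ℕ→ℚ k * a)
  ka-nonNeg = nonNeg*nonNeg⇒nonNeg (ℕ→ℚ k) {{normalize-nonNeg k 1}} a {{pos⇒nonNeg a}}

ℕ→ℚ*pos*pos≡0⇔≡0 : ∀ k a b .{{_ : Positive a}} .{{_ : Positive b}} → ℕ→ℚ k * a * b ≡ 0ℚ ⇔ k ≡ 0
ℕ→ℚ*pos*pos≡0⇔≡0 k a b = mk⇔ (to k) (λ { refl → trans (cong (_* b) (*-zeroˡ a)) (*-zeroˡ b) })
  where
  to : ∀ k → ℕ→ℚ k * a * b ≡ 0ℚ → k ≡ 0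
  to zero    _  = refl
  to (suc n) eq = contradiction (sym eq) (<⇒≢ (positive⁻¹ (ℕ→ℚ (suc n) * a * b) {{pos}}))
    where
    pos : Positive (ℕ→ℚ (suc n) * a * b)
    pos = pos*pos⇒pos (ℕ→ℚ (suc n) * a) {{pos*pos⇒pos (ℕ→ℚ (suc n)) {{normalize-pos (suc n) 1}} a}} b

∣p─q∣*∣q─p∣≡0⇔p⊆q⊎q⊆p : ∀ {n} (p q : Subset n) → ∣ p ─ q ∣ *ℕ ∣ q ─ p ∣ ≡ 0 ⇔ (p ⊆ q ⊎ q ⊆ p)
∣p─q∣*∣q─p∣≡0⇔p⊆q⊎q⊆p p q = mk⇔
  (Sum.map (∣p─q∣≡0⇒p⊆q p q) (∣p─q∣≡0⇒p⊆q q p) ∘ ℕ.m*n≡0⇒m≡0∨n≡0 ∣ p ─ q ∣)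
  Sum.[ (λ p⊆q → cong (_*ℕ ∣ q ─ p ∣) (p⊆q⇒∣p─q∣≡0 p q p⊆q))
      , (λ q⊆p → trans (cong (∣ p ─ q ∣ *ℕ_) (p⊆q⇒∣p─q∣≡0 q p q⊆p)) (ℕ.*-zeroʳ ∣ p ─ q ∣)) ]

lemma3p4 : (m : ℕ) .{{_ : NonZero m}} (I T : Subset m) .{{_ : NonZero ∣ I ∣}} .{{_ : NonZero ∣ T ∣}} →
             (tr (Q m I ⊗ Q m T) ≡ ℕ→ℚ ∣ I ∩ T ∣ + ℕ→ℚ (∣ I ─ T ∣ *ℕ ∣ T ─ I ∣) * (+ 1 / ∣ I ∣) * (+ 1 / ∣ T ∣))
             × (ℕ→ℚ ∣ I ∩ T ∣ ≤ tr (Q m I ⊗ Q m T))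
             × ((tr (Q m I ⊗ Q m T) ≡ ℕ→ℚ ∣ I ∩ T ∣) ⇔ (I ⊆ T ⊎ T ⊆ I))
lemma3p4 m I T = trace , subst (c ≤_) (sym trace) (p≤p+q c excess {{ℕ→ℚ*pos*pos-nonNeg k α β}}) , equality
  where
  instance
    _ : Positive (+ 1 / ∣ I ∣)
    _ = normalize-pos 1 ∣ I ∣
    _ : Positive (+ 1 / ∣ T ∣)
    _ = normalize-pos 1 ∣ T ∣
  α = + 1 / ∣ I ∣
  β = + 1 / ∣ T ∣
  c = ℕ→ℚ ∣ I ∩ T ∣
  k = ∣ I ─ T ∣ *ℕ ∣ T ─ I ∣
  excess = ℕ→ℚ k * α * β
  trace : tr (Q m I ⊗ Q m T) ≡ c + excess
  trace = tr-Q⊗Q-excess I T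
  equality : (tr (Q m I ⊗ Q m T) ≡ c) ⇔ (I ⊆ T ⊎ T ⊆ I)
  equality = subst (λ t → (t ≡ c) ⇔ (I ⊆ T ⊎ T ⊆ I)) (sym trace)
    (⇔-trans (p+q≡p⇔q≡0 c excess) (⇔-trans (ℕ→ℚ*pos*pos≡0⇔≡0 k α β) (∣p─q∣*∣q─p∣≡0⇔p⊆q⊎q⊆p I T)))
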